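{- Let $k$ be a non-negative integer and let $v, w$ be finite binary words with $\mathrm{len}(v) = \mathrm{len}(w) + k$, such that $v$ does not contain $w$ as a (contiguous) subword. Then $$\mathrm{Win}\left(v,w;\tfrac{1}{2}\right) < \frac{2}{1+2^k},$$ and this bound is achieved asymptotically: $\mathrm{Win}\left(0^{k+1}1^{n-1}, 1^n; \tfrac{1}{2}\right) \to \frac{2}{1+2^k}$ as $n \to \infty$.
   Context: For $p\in(0,1)$, let $\mathbb{P}_p$ denote the law of an i.i.d. sequence $X_1, X_2, \ldots$ of bits with $\mathbb{P}_p(X_i = 1) = p$, $\mathbb{P}_p(X_i=0)=1-p$. For a binary word $u = u_1\cdots u_r$, let $\tau_u = \min\{t \in \mathbb{N} : X_{t-r+1}\cdots X_t = u_1\cdots u_r\}$. Define $\mathrm{Win}(v,w;p) = \mathbb{P}_p(\tau_v < \tau_w)$. For $a\in\{0,1\}$, $a^m$ denotes the word consisting of $m$ copies of $a$, and juxtaposition denotes concatenation of words. -}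

module Defs where

open import Data.Bool using (Bool; true; false; if_then_else_)
open import Data.Nat using (ℕ; zero; suc; _+_; _^_)
open import Data.Nat.Properties using (m^n≢0)
open import Data.Integer using (+_)
open import Data.List using (List; []; _∷_; reverse; _++_; map; length; filterᵇ)
open import Data.Rational using (ℚ; _/_; _≤_)
open import Data.Product using (∃)
open import Relation.Binary.PropositionalEquality using (_≡_)
open import Relation.Nullary.Decidable using (does)
open import Data.Bool.Properties using () renaming (_≟_ to _≟ᵇ_)

-- A bit is a Bool: false = 0, true = 1.  A binary word is a List Bool.

rep : ℕ → Bool → List Bool
rep zero    a = []
rep (suc m) a = a ∷ rep m a

isPrefix : List Bool → List Bool → Bool
isPrefix []       ys       = true
isPrefix (x ∷ xs) []       = false
isPrefix (x ∷ xs) (y ∷ ys) = if does (x ≟ᵇ y) then isPrefix xs ys else false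

-- 'acc' is the (reversed) history X_t ... X_1 observed so far, 'rest' the
-- remaining bits.
-- At a time where both appear simultaneously, the event tau_v < tau_w fails.
vFirst : List Bool → List Bool → List Bool → List Bool → Bool
vFirst v w acc []       = false
vFirst v w acc (b ∷ r) =
  if isPrefix (reverse w) (b ∷ acc) then false
  else if isPrefix (reverse v) (b ∷ acc) then true
  else vFirst v w (b ∷ acc) r

words : ℕ → List (List Bool)
words zero    = [] ∷ []
words (suc T) = map (false ∷_) (words T) ++ map (true ∷_) (words T)

countWin : List Bool → List Bool → ℕ → ℕ
countWin v w T = length (filterᵇ (vFirst v w []) (words T))

-- P_{1/2}(tau_v < tau_w and tau_v <= T) = countWin / 2^T
winUpTo : List Bool → List Bool → ℕ → ℚ
winUpTo v w T = _/_ (+ countWin v w T) (2 ^ T) {{m^n≢0 2 T}}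

-- Win(v,w;1/2) = P(tau_v < tau_w) is the increasing limit (supremum) of
-- winUpTo v w T as T → ∞.  Comparisons of Win with rationals:
-- Win(v,w;1/2) ≤ c
WinAtMost : List Bool → List Bool → ℚ → Set
WinAtMost v w c = ∀ T → winUpTo v w T ≤ c

-- Win(v,w;1/2) ≥ c'  approximately: some finite horizon already reaches c
ReachedBy : List Bool → List Bool → ℚ → Set
ReachedBy v w c = ∃ λ T → c ≤ winUpTo v w T

-- Conway's martingale argument, cut off at a finite horizon.  Store a history with its
-- latest bit first and let Φ y x be the capital of Conway's gamblers on y: the sum of 2^i
-- over the i ≤ |y| for which the last i bits of x spell the first i letters of y.  Until y
-- occurs, Φ y grows by exactly 1 per fair bit in expectation, so Φ v − Φ w is a martingale
-- up to the end of the race between v and w, and its expectation at the stopped history is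
-- 0 at every horizon.  When v wins, Φ v ≥ 2^|v| and Φ w ≤ 2^|w| − 2, while always
-- Φ w ≤ 2^(|w|+1) − 2; hence (2^|v| + 2^|w|) P(v wins by time T) ≤ 2^(|w|+1) − 2, which is
-- the bound with margin 2 / (2^|w| (1 + 2^k)).  For v = 0^(k+1) 1^(n−1) and w = 1^n these
-- estimates are equalities, and the martingale Φ w − t shows that the race is still
-- undecided at time T with probability at most 2^(n+1) / T; so at a large enough horizon v
-- wins with probability within O(2^−n) of 2 / (1 + 2^k).

module Submission where

open import Defs
open import Data.Bool using (Bool; true; false)
open import Data.Nat using (ℕ; _+_; _^_; _∸_) renaming (_≤_ to _≤ℕ_)
open import Data.Integer using (+_)
open import Data.List using (List; length; _++_)
open import Data.List.Relation.Binary.Infix.Heterogeneous using (Infix)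
open import Data.Rational using (ℚ; _/_; _<_; _-_; 0ℚ) renaming (_+_ to _+ℚ_)
open import Data.Product using (_×_; ∃)
open import Relation.Binary.PropositionalEquality using (_≡_)
open import Relation.Nullary using (¬_)
open import Data.Nat using (zero; suc; _*_; NonZero; s≤s; z≤n)
open import Data.Nat.Properties
  using (m^n≢0; m*n≢0; m^n>0; ^-distribˡ-+-*; ^-monoʳ-≤; +-comm; +-mono-≤; ≤-trans; ≤-refl;
         m≤m+n; n≤1+n; *-monoʳ-≤; *-monoˡ-≤; module ≤-Reasoning)
open import Data.Nat.Tactic.RingSolver using (solve-∀)
open import Data.Integer using (+[1+_]; -[1+_])
import Data.Integer as ℤ
import Data.Integer.Properties as ℤ
open import Data.Rational using (-_; mkℚ; toℚᵘ; *<*) renaming (_≤_ to _≤ℚ_)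
import Data.Rational.Properties as ℚ
import Data.Rational.Unnormalised as ℚᵘ
import Data.Rational.Unnormalised.Properties as ℚᵘ
open import Data.List using ([]; _∷_)
open import Data.List.Relation.Binary.Infix.Heterogeneous using (here)
open import Data.List.Relation.Binary.Prefix.Heterogeneous using ([])
open import Data.Product using (_,_)
open import Relation.Binary.PropositionalEquality using (_≢_; refl; sym; trans; cong; cong₂; subst; subst₂)

module Penney where

  open import Data.Bool using (if_then_else_; not; _∧_; _∨_)
  open import Data.Bool.Properties using (∨-conicalˡ; ∨-conicalʳ)
  open import Data.Nat using (_≤_)
  open import Data.Nat.Properties
  open import Data.List using (reverse; _ʳ++_; map; filterᵇ)
  open import Data.List.Properties
    using (length-++; filter-++; reverse-injective; reverse-++; ++-identityʳ; ++-assoc)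
  open import Relation.Binary.PropositionalEquality using (module ≡-Reasoning)
  open import Data.Empty using (⊥-elim)
  open import Relation.Nullary.Decidable using (T?)
  open import Function using (_∘_)
  import Algebra.Properties.CommutativeSemigroup +-commutativeSemigroup as +-CS
  import Algebra.Properties.CommutativeSemigroup *-commutativeSemigroup as *-CS

  iverson : Bool → ℕ → ℕ
  iverson b n = if b then n else 0

  iverson-≤ : ∀ b n → iverson b n ≤ n
  iverson-≤ true  n = ≤-refl
  iverson-≤ false n = z≤n

  iverson-*ˡ : ∀ b m n → iverson b (m * n) ≡ m * iverson b n
  iverson-*ˡ true  m n = refl
  iverson-*ˡ false m n = sym (*-zeroʳ m)

  iverson-scale : ∀ b n → iverson b n ≡ n * iverson b 1
  iverson-scale true  n = sym (*-identityʳ n)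
  iverson-scale false n = sym (*-zeroʳ n)

  count : (List Bool → Bool) → ℕ → ℕ
  count g T = length (filterᵇ g (words T))

  length-filterᵇ-map-∷ : ∀ g (b : Bool) xs →
    length (filterᵇ g (map (b ∷_) xs)) ≡ length (filterᵇ (g ∘ (b ∷_)) xs)
  length-filterᵇ-map-∷ g b []       = refl
  length-filterᵇ-map-∷ g b (x ∷ xs) with g (b ∷ x)
  ... | true  = cong suc (length-filterᵇ-map-∷ g b xs)
  ... | false = length-filterᵇ-map-∷ g b xs

  count-suc : ∀ g T → count g (suc T) ≡ count (g ∘ (false ∷_)) T + count (g ∘ (true ∷_)) T
  count-suc g T = begin
    length (filterᵇ g (map (false ∷_) (words T) ++ map (true ∷_) (words T)))
      ≡⟨ cong length (filter-++ (T? ∘ g) (map (false ∷_) (words T)) _) ⟩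
    length (filterᵇ g (map (false ∷_) (words T)) ++ filterᵇ g (map (true ∷_) (words T)))
      ≡⟨ length-++ (filterᵇ g (map (false ∷_) (words T))) ⟩
    length (filterᵇ g (map (false ∷_) (words T))) + length (filterᵇ g (map (true ∷_) (words T)))
      ≡⟨ cong₂ _+_ (length-filterᵇ-map-∷ g false (words T)) (length-filterᵇ-map-∷ g true (words T)) ⟩
    count (g ∘ (false ∷_)) T + count (g ∘ (true ∷_)) T ∎
    where open ≡-Reasoning

  count-const : ∀ c T → count (λ _ → c) T ≡ iverson c (2 ^ T)
  count-const true  zero    = refl
  count-const false zero    = refl
  count-const c     (suc T) = begin
    count (λ _ → c) (suc T)             ≡⟨ count-suc (λ _ → c) T ⟩
    count (λ _ → c) T + count (λ _ → c) T ≡⟨ cong₂ _+_ (count-const c T) (count-const c T) ⟩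
    iverson c (2 ^ T) + iverson c (2 ^ T) ≡⟨ cong (_+_ (iverson c (2 ^ T))) (sym (+-identityʳ _)) ⟩
    2 * iverson c (2 ^ T)                 ≡⟨ sym (iverson-*ˡ c 2 (2 ^ T)) ⟩
    iverson c (2 ^ suc T)                 ∎
    where open ≡-Reasoning

  module Stopping (halt : List Bool → Bool) where

    -- stopped T f a is 2^T times the expectation of f at the history obtained by extending a
    -- with T fair bits, frozen at the first history where halt holds.
    stopped : ℕ → (List Bool → ℕ) → List Bool → ℕ
    stopped zero    f a = f a
    stopped (suc T) f a with halt a
    ... | true  = 2 ^ suc T * f a
    ... | false = stopped T f (false ∷ a) + stopped T f (true ∷ a)

    Drift : ℕ → (List Bool → ℕ) → Set
    Drift c f = ∀ a → halt a ≡ false → f (false ∷ a) + f (true ∷ a) ≡ 2 * f a + c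

    drift-+ : ∀ {c} f d → Drift c f → Drift c (λ s → f s + d)
    drift-+ {c} f d drift a live = begin
      f (false ∷ a) + d + (f (true ∷ a) + d) ≡⟨ shuffle (f (false ∷ a)) (f (true ∷ a)) d ⟩
      f (false ∷ a) + f (true ∷ a) + 2 * d   ≡⟨ cong (_+ 2 * d) (drift a live) ⟩
      2 * f a + c + 2 * d                     ≡⟨ regroup (f a) c d ⟩
      2 * (f a + d) + c                       ∎
      where
      open ≡-Reasoning
      shuffle : ∀ x y d → x + d + (y + d) ≡ x + y + 2 * d
      shuffle = solve-∀
      regroup : ∀ x c d → 2 * x + c + 2 * d ≡ 2 * (x + d) + c
      regroup = solve-∀

    drift-length : Drift 2 length
    drift-length a _ = double-suc (length a)
      where
      double-suc : ∀ n → suc n + suc n ≡ 2 * n + 2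
      double-suc = solve-∀

    stopped-halted : ∀ T f a → halt a ≡ true → stopped T f a ≡ 2 ^ T * f a
    stopped-halted zero    f a _ = sym (*-identityˡ (f a))
    stopped-halted (suc T) f a halted with halt a
    ... | true = refl

    stopped-live : ∀ T f a → halt a ≡ false →
      stopped (suc T) f a ≡ stopped T f (false ∷ a) + stopped T f (true ∷ a)
    stopped-live T f a live with halt a
    ... | false = refl

    stopped-+ : ∀ T f g a → stopped T (λ s → f s + g s) a ≡ stopped T f a + stopped T g a
    stopped-+ zero    f g a = refl
    stopped-+ (suc T) f g a with halt a
    ... | true  = *-distribˡ-+ (2 ^ suc T) (f a) (g a)
    ... | false = trans (cong₂ _+_ (stopped-+ T f g (false ∷ a)) (stopped-+ T f g (true ∷ a)))
                        (+-CS.interchange (stopped T f (false ∷ a)) _ _ _)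

    stopped-iverson : ∀ T n (b : List Bool → Bool) a →
      stopped T (λ s → iverson (b s) n) a ≡ n * stopped T (λ s → iverson (b s) 1) a
    stopped-iverson zero    n b a = iverson-scale (b a) n
    stopped-iverson (suc T) n b a with halt a
    ... | true  = trans (cong (2 ^ suc T *_) (iverson-scale (b a) n)) (*-CS.x∙yz≈y∙xz (2 ^ suc T) n _)
    ... | false = trans (cong₂ _+_ (stopped-iverson T n b (false ∷ a)) (stopped-iverson T n b (true ∷ a)))
                        (sym (*-distribˡ-+ n (stopped T (λ s → iverson (b s) 1) (false ∷ a)) _))

    stopped-zero : ∀ T a → stopped T (λ _ → 0) a ≡ 0
    stopped-zero zero    a = refl
    stopped-zero (suc T) a with halt a
    ... | true  = *-zeroʳ (2 ^ suc T)
    ... | false = cong₂ _+_ (stopped-zero T (false ∷ a)) (stopped-zero T (true ∷ a))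

    -- Optional stopping for the martingale f − g, kept free of subtraction: if h₁ − h₂ ≤ f − g
    -- at every history, then the stopped expectation of h₁ − h₂ is at most (f − g) a.
    optional-stopping : ∀ {c} f g h₁ h₂ → Drift c f → Drift c g →
      (∀ s → h₁ s + g s ≤ f s + h₂ s) →
      ∀ T a → stopped T h₁ a + 2 ^ T * g a ≤ 2 ^ T * f a + stopped T h₂ a
    optional-stopping {c} f g h₁ h₂ drift-f drift-g bound = go
      where
      averaged : ∀ {t g₀ g₁ gₐ f₀ f₁ fₐ x₀ x₁ y₀ y₁} →
        g₀ + g₁ ≡ 2 * gₐ + c → f₀ + f₁ ≡ 2 * fₐ + c →
        x₀ + t * g₀ ≤ t * f₀ + y₀ → x₁ + t * g₁ ≤ t * f₁ + y₁ →
        x₀ + x₁ + 2 * t * gₐ ≤ 2 * t * fₐ + (y₀ + y₁)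
      averaged {t} {g₀} {g₁} {gₐ} {f₀} {f₁} {fₐ} {x₀} {x₁} {y₀} {y₁} eg ef le₀ le₁ =
        +-cancelʳ-≤ (t * c) _ _ (begin
          x₀ + x₁ + 2 * t * gₐ + t * c    ≡⟨ split-g x₀ x₁ t gₐ c ⟩
          x₀ + x₁ + t * (2 * gₐ + c)      ≡⟨ cong (λ z → x₀ + x₁ + t * z) (sym eg) ⟩
          x₀ + x₁ + t * (g₀ + g₁)         ≡⟨ regroup x₀ x₁ t g₀ g₁ ⟩
          (x₀ + t * g₀) + (x₁ + t * g₁)   ≤⟨ +-mono-≤ le₀ le₁ ⟩
          (t * f₀ + y₀) + (t * f₁ + y₁)   ≡⟨ regroup′ t f₀ f₁ y₀ y₁ ⟩
          t * (f₀ + f₁) + (y₀ + y₁)       ≡⟨ cong (λ z → t * z + (y₀ + y₁)) ef ⟩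
          t * (2 * fₐ + c) + (y₀ + y₁)    ≡⟨ split-f t fₐ c y₀ y₁ ⟩
          2 * t * fₐ + (y₀ + y₁) + t * c  ∎)
        where
        open ≤-Reasoning
        split-g : ∀ x₀ x₁ t g c → x₀ + x₁ + 2 * t * g + t * c ≡ x₀ + x₁ + t * (2 * g + c)
        split-g = solve-∀
        regroup : ∀ x₀ x₁ t g₀ g₁ → x₀ + x₁ + t * (g₀ + g₁) ≡ (x₀ + t * g₀) + (x₁ + t * g₁)
        regroup = solve-∀
        regroup′ : ∀ t f₀ f₁ y₀ y₁ → (t * f₀ + y₀) + (t * f₁ + y₁) ≡ t * (f₀ + f₁) + (y₀ + y₁)
        regroup′ = solve-∀
        split-f : ∀ t f c y₀ y₁ → t * (2 * f + c) + (y₀ + y₁) ≡ 2 * t * f + (y₀ + y₁) + t * c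
        split-f = solve-∀

      go : ∀ T a → stopped T h₁ a + 2 ^ T * g a ≤ 2 ^ T * f a + stopped T h₂ a
      go zero a rewrite *-identityˡ (g a) | *-identityˡ (f a) = bound a
      go (suc T) a with halt a in halted
      ... | true  = begin
        2 ^ suc T * h₁ a + 2 ^ suc T * g a ≡⟨ sym (*-distribˡ-+ (2 ^ suc T) (h₁ a) (g a)) ⟩
        2 ^ suc T * (h₁ a + g a)           ≤⟨ *-monoʳ-≤ (2 ^ suc T) (bound a) ⟩
        2 ^ suc T * (f a + h₂ a)           ≡⟨ *-distribˡ-+ (2 ^ suc T) (f a) (h₂ a) ⟩
        2 ^ suc T * f a + 2 ^ suc T * h₂ a ∎
        where open ≤-Reasoning
      ... | false = averaged {2 ^ T} (drift-g a halted) (drift-f a halted)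
                      (go T (false ∷ a)) (go T (true ∷ a))

    stopped-length : ∀ T a →
      stopped T (λ s → iverson (not (halt s)) (length s)) a ≡
      (length a + T) * stopped T (λ s → iverson (not (halt s)) 1) a
    stopped-length zero a with halt a
    ... | true  = sym (*-zeroʳ (length a + 0))
    ... | false = sym (trans (*-identityʳ (length a + 0)) (+-identityʳ (length a)))
    stopped-length (suc T) a with halt a in h
    ... | true  rewrite h | *-zeroʳ (2 ^ suc T) = sym (*-zeroʳ (length a + suc T))
    ... | false = begin
      stopped T age (false ∷ a) + stopped T age (true ∷ a)
        ≡⟨ cong₂ _+_ (stopped-length T (false ∷ a)) (stopped-length T (true ∷ a)) ⟩
      suc (length a + T) * U₀ + suc (length a + T) * U₁
        ≡⟨ sym (*-distribˡ-+ (suc (length a + T)) U₀ U₁) ⟩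
      suc (length a + T) * (U₀ + U₁)
        ≡⟨ cong (_* (U₀ + U₁)) (sym (+-suc (length a) T)) ⟩
      (length a + suc T) * (U₀ + U₁) ∎
      where
      open ≡-Reasoning
      age undecided : List Bool → ℕ
      age s       = iverson (not (halt s)) (length s)
      undecided s = iverson (not (halt s)) 1
      U₀ = stopped T undecided (false ∷ a)
      U₁ = stopped T undecided (true ∷ a)

  -- Histories are stored latest bit first.  conway y r p x is the sum of p 2^i over the
  -- i ≤ |y| such that (y₁ ⋯ yᵢ) ʳ++ r is a prefix of x; Φ y x is the capital of Conway's
  -- gamblers on y at history x.
  conway : List Bool → List Bool → ℕ → List Bool → ℕ
  conway []      r p x = 0
  conway (c ∷ y) r p x = iverson (isPrefix (c ∷ r) x) (2 * p) + conway y (c ∷ r) (2 * p) x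

  Φ : List Bool → List Bool → ℕ
  Φ y = conway y [] 1

  conway-[] : ∀ y r p → conway y r p [] ≡ 0
  conway-[] []      r p = refl
  conway-[] (c ∷ y) r p = conway-[] y (c ∷ r) (2 * p)

  iverson-isPrefix-∷ : ∀ c r x q →
    iverson (isPrefix (c ∷ r) (false ∷ x)) q + iverson (isPrefix (c ∷ r) (true ∷ x)) q
      ≡ iverson (isPrefix r x) q
  iverson-isPrefix-∷ false r x q = +-identityʳ _
  iverson-isPrefix-∷ true  r x q = refl

  p*[2*q]≡2*p*q : ∀ p q → p * (2 * q) ≡ 2 * p * q
  p*[2*q]≡2*p*q = solve-∀

  p*2^1≡2*p : ∀ p → p * 2 ^ 1 ≡ 2 * p
  p*2^1≡2*p = solve-∀

  -- Averaging over the next bit shifts every gambler by one letter: a new stake enters (the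
  -- last term) and the gambler who has already spelled all of y drops out (the third term).
  conway-drift : ∀ y r p x →
    conway y r p (false ∷ x) + conway y r p (true ∷ x) + 2 * iverson (isPrefix (y ʳ++ r) x) (p * 2 ^ length y)
      ≡ 2 * conway y r p x + iverson (isPrefix r x) (2 * p)
  conway-drift [] r p x = trans (sym (iverson-*ˡ (isPrefix r x) 2 (p * 1)))
                                (cong (λ q → iverson (isPrefix r x) (2 * q)) (*-identityʳ p))
  conway-drift (c ∷ y) r p x = begin
    (i₀ + C₀) + (i₁ + C₁) + 2 * iverson full (p * (2 * 2 ^ length y))
      ≡⟨ cong (λ q → (i₀ + C₀) + (i₁ + C₁) + 2 * iverson full q) (p*[2*q]≡2*p*q p (2 ^ length y)) ⟩
    (i₀ + C₀) + (i₁ + C₁) + 2 * iverson full (2 * p * 2 ^ length y)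
      ≡⟨ regroup i₀ C₀ i₁ C₁ _ ⟩
    (C₀ + C₁ + 2 * iverson full (2 * p * 2 ^ length y)) + (i₀ + i₁)
      ≡⟨ cong₂ _+_ (conway-drift y (c ∷ r) (2 * p) x) (iverson-isPrefix-∷ c r x (2 * p)) ⟩
    2 * C + iverson (isPrefix (c ∷ r) x) (2 * (2 * p)) + iverson (isPrefix r x) (2 * p)
      ≡⟨ cong (λ z → 2 * C + z + iverson (isPrefix r x) (2 * p)) (iverson-*ˡ (isPrefix (c ∷ r) x) 2 (2 * p)) ⟩
    2 * C + 2 * i + iverson (isPrefix r x) (2 * p)
      ≡⟨ regroup′ C i _ ⟩
    2 * (i + C) + iverson (isPrefix r x) (2 * p) ∎
    where
    open ≡-Reasoning
    full = isPrefix (y ʳ++ (c ∷ r)) x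
    i  = iverson (isPrefix (c ∷ r) x) (2 * p)
    i₀ = iverson (isPrefix (c ∷ r) (false ∷ x)) (2 * p)
    i₁ = iverson (isPrefix (c ∷ r) (true ∷ x)) (2 * p)
    C  = conway y (c ∷ r) (2 * p) x
    C₀ = conway y (c ∷ r) (2 * p) (false ∷ x)
    C₁ = conway y (c ∷ r) (2 * p) (true ∷ x)
    regroup : ∀ i₀ C₀ i₁ C₁ F → (i₀ + C₀) + (i₁ + C₁) + F ≡ (C₀ + C₁ + F) + (i₀ + i₁)
    regroup = solve-∀
    regroup′ : ∀ C i j → 2 * C + 2 * i + j ≡ 2 * (i + C) + j
    regroup′ = solve-∀

  conway-≤ : ∀ c y r p x →
    conway (c ∷ y) r p x + 2 * p
      ≤ p * 2 ^ length (c ∷ y) + iverson (isPrefix ((c ∷ y) ʳ++ r) x) (p * 2 ^ length (c ∷ y))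
  conway-≤ c [] r p x = ≤-reflexive (begin-equality
    i + 0 + 2 * p                               ≡⟨ cong (_+ 2 * p) (+-identityʳ i) ⟩
    i + 2 * p                                   ≡⟨ +-comm i (2 * p) ⟩
    2 * p + i                                   ≡⟨ cong (λ q → q + iverson b q) (sym (p*2^1≡2*p p)) ⟩
    p * 2 ^ 1 + iverson b (p * 2 ^ 1)           ∎)
    where
    open ≤-Reasoning
    b = isPrefix (c ∷ r) x
    i = iverson b (2 * p)
  conway-≤ c (d ∷ y) r p x = begin
    i + C + 2 * p         ≤⟨ +-monoˡ-≤ (2 * p) (+-monoˡ-≤ C (iverson-≤ (isPrefix (c ∷ r) x) (2 * p))) ⟩
    2 * p + C + 2 * p     ≡⟨ regroup p C ⟩
    C + 2 * (2 * p)       ≤⟨ conway-≤ d y (c ∷ r) (2 * p) x ⟩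
    2 * p * n + iverson full (2 * p * n)  ≡⟨ cong (λ q → q + iverson full q) (sym (p*[2*q]≡2*p*q p n)) ⟩
    p * (2 * n) + iverson full (p * (2 * n)) ∎
    where
    open ≤-Reasoning
    n = 2 ^ length (d ∷ y)
    full = isPrefix ((c ∷ d ∷ y) ʳ++ r) x
    i = iverson (isPrefix (c ∷ r) x) (2 * p)
    C = conway (d ∷ y) (c ∷ r) (2 * p) x
    regroup : ∀ p C → 2 * p + C + 2 * p ≡ C + 2 * (2 * p)
    regroup = solve-∀

  conway-≥ : ∀ c y r p x →
    iverson (isPrefix ((c ∷ y) ʳ++ r) x) (p * 2 ^ length (c ∷ y)) ≤ conway (c ∷ y) r p x
  conway-≥ c [] r p x =
    ≤-reflexive (trans (cong (iverson (isPrefix (c ∷ r) x)) (p*2^1≡2*p p)) (sym (+-identityʳ _)))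
  conway-≥ c (d ∷ y) r p x = begin
    iverson full (p * (2 * n))        ≡⟨ cong (iverson full) (p*[2*q]≡2*p*q p n) ⟩
    iverson full (2 * p * n)          ≤⟨ conway-≥ d y (c ∷ r) (2 * p) x ⟩
    conway (d ∷ y) (c ∷ r) (2 * p) x  ≤⟨ m≤n+m _ (iverson (isPrefix (c ∷ r) x) (2 * p)) ⟩
    conway (c ∷ d ∷ y) r p x          ∎
    where
    open ≤-Reasoning
    n = 2 ^ length (d ∷ y)
    full = isPrefix ((c ∷ d ∷ y) ʳ++ r) x

  Φ-[] : ∀ y → Φ y [] ≡ 0
  Φ-[] y = conway-[] y [] 1

  Φ-drift : ∀ y x → isPrefix (reverse y) x ≡ false → Φ y (false ∷ x) + Φ y (true ∷ x) ≡ 2 * Φ y x + 2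
  Φ-drift y x unmatched = begin
    Φ y (false ∷ x) + Φ y (true ∷ x)                 ≡⟨ sym (+-identityʳ _) ⟩
    Φ y (false ∷ x) + Φ y (true ∷ x) + 2 * iverson false (1 * 2 ^ length y)
      ≡⟨ cong (λ b → Φ y (false ∷ x) + Φ y (true ∷ x) + 2 * iverson b (1 * 2 ^ length y)) (sym unmatched) ⟩
    Φ y (false ∷ x) + Φ y (true ∷ x) + 2 * iverson (isPrefix (reverse y) x) (1 * 2 ^ length y)
      ≡⟨ conway-drift y [] 1 x ⟩
    2 * Φ y x + 2                                     ∎
    where open ≡-Reasoning

  Φ-≤ : ∀ y x → Φ y x + 2 ≤ 2 * 2 ^ length y
  Φ-≤ []      x = ≤-refl
  Φ-≤ (c ∷ y) x = begin
    Φ (c ∷ y) x + 2                                   ≤⟨ conway-≤ c y [] 1 x ⟩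
    1 * n + iverson (isPrefix (reverse (c ∷ y)) x) (1 * n) ≤⟨ +-monoʳ-≤ (1 * n) (iverson-≤ _ (1 * n)) ⟩
    1 * n + 1 * n                                     ≡⟨ double n ⟩
    2 * n                                             ∎
    where
    open ≤-Reasoning
    n = 2 ^ length (c ∷ y)
    double : ∀ n → 1 * n + 1 * n ≡ 2 * n
    double = solve-∀

  Φ-unmatched-≤ : ∀ y x → isPrefix (reverse y) x ≡ false → Φ y x + 2 ≤ 2 ^ length y
  Φ-unmatched-≤ (c ∷ y) x unmatched = begin
    Φ (c ∷ y) x + 2                                   ≤⟨ conway-≤ c y [] 1 x ⟩
    1 * n + iverson (isPrefix (reverse (c ∷ y)) x) (1 * n) ≡⟨ cong (λ b → 1 * n + iverson b (1 * n)) unmatched ⟩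
    1 * n + 0                                         ≡⟨ trans (+-identityʳ (1 * n)) (*-identityˡ n) ⟩
    n                                                 ∎
    where
    open ≤-Reasoning
    n = 2 ^ length (c ∷ y)

  Φ-matched-≥ : ∀ y x → y ≢ [] → isPrefix (reverse y) x ≡ true → 2 ^ length y ≤ Φ y x
  Φ-matched-≥ []      x nonempty _ = ⊥-elim (nonempty refl)
  Φ-matched-≥ (c ∷ y) x _ matched = begin
    n                                                 ≡⟨ sym (*-identityˡ n) ⟩
    1 * n                                             ≡⟨ cong (λ b → iverson b (1 * n)) (sym matched) ⟩
    iverson (isPrefix (reverse (c ∷ y)) x) (1 * n)    ≤⟨ conway-≥ c y [] 1 x ⟩
    Φ (c ∷ y) x                                       ∎
    where
    open ≤-Reasoning
    n = 2 ^ length (c ∷ y)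

  isPrefix-reverse-[] : ∀ y → y ≢ [] → isPrefix (reverse y) [] ≡ false
  isPrefix-reverse-[] y y≢[] with reverse y in eq
  ... | []    = ⊥-elim (y≢[] (reverse-injective eq))
  ... | _ ∷ _ = refl

  module Race (v w : List Bool) where

    halted : List Bool → Bool
    halted a = isPrefix (reverse w) a ∨ isPrefix (reverse v) a

    vWins : List Bool → Bool
    vWins a = not (isPrefix (reverse w) a) ∧ isPrefix (reverse v) a

    open Stopping halted public

    -- 2^T times the probabilities that v has won by time T and that neither word has occurred
    -- by time T.  As in vFirst, a simultaneous occurrence counts for w.
    wins survivors : ℕ → ℕ
    wins      T = stopped T (λ s → iverson (vWins s) 1) []
    survivors T = stopped T (λ s → iverson (not (halted s)) 1) []

    drift-Φw : Drift 2 (Φ w)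
    drift-Φw a live = Φ-drift w a (∨-conicalˡ _ _ live)

    drift-Φv : Drift 2 (Φ v)
    drift-Φv a live = Φ-drift v a (∨-conicalʳ _ _ live)

    vWins-live : ∀ a → halted a ≡ false → vWins a ≡ false
    vWins-live a live with isPrefix (reverse w) a | isPrefix (reverse v) a
    vWins-live a ()   | true  | _
    vWins-live a ()   | false | true
    vWins-live a refl | false | false = refl

    count-vFirst : ∀ T a → halted a ≡ false →
      count (vFirst v w a) T ≡ stopped T (λ s → iverson (vWins s) 1) a
    count-vFirst zero    a live = cong (λ b → iverson b 1) (sym (vWins-live a live))
    count-vFirst (suc T) a live = begin
      count (vFirst v w a) (suc T)
        ≡⟨ count-suc (vFirst v w a) T ⟩
      count (λ r → vFirst v w a (false ∷ r)) T + count (λ r → vFirst v w a (true ∷ r)) T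
        ≡⟨ cong₂ _+_ (step false) (step true) ⟩
      stopped T won (false ∷ a) + stopped T won (true ∷ a)
        ≡⟨ sym (stopped-live T won a live) ⟩
      stopped (suc T) won a ∎
      where
      open ≡-Reasoning
      won : List Bool → ℕ
      won s = iverson (vWins s) 1
      step : ∀ b → count (λ r → vFirst v w a (b ∷ r)) T ≡ stopped T won (b ∷ a)
      step b with isPrefix (reverse w) (b ∷ a) in w-seen
      ... | true = begin
        count (λ _ → false) T      ≡⟨ count-const false T ⟩
        0                          ≡⟨ sym (*-zeroʳ (2 ^ T)) ⟩
        2 ^ T * 0                  ≡⟨ cong (λ z → 2 ^ T * iverson (not z ∧ _) 1) (sym w-seen) ⟩
        2 ^ T * won (b ∷ a)        ≡⟨ sym (stopped-halted T won (b ∷ a) (cong (_∨ _) w-seen)) ⟩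
        stopped T won (b ∷ a)      ∎
      ... | false with isPrefix (reverse v) (b ∷ a) in v-seen
      ...   | true = begin
        count (λ _ → true) T       ≡⟨ count-const true T ⟩
        2 ^ T                      ≡⟨ sym (*-identityʳ (2 ^ T)) ⟩
        2 ^ T * 1                  ≡⟨ cong₂ (λ z z′ → 2 ^ T * iverson (not z ∧ z′) 1) (sym w-seen) (sym v-seen) ⟩
        2 ^ T * won (b ∷ a)        ≡⟨ sym (stopped-halted T won (b ∷ a) (cong₂ _∨_ w-seen v-seen)) ⟩
        stopped T won (b ∷ a)      ∎
      ...   | false = count-vFirst T (b ∷ a) (cong₂ _∨_ w-seen v-seen)

    countWin≡wins : v ≢ [] → w ≢ [] → ∀ T → countWin v w T ≡ wins T
    countWin≡wins v≢[] w≢[] T =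
      count-vFirst T [] (cong₂ _∨_ (isPrefix-reverse-[] w w≢[]) (isPrefix-reverse-[] v v≢[]))

    wins-≤ : v ≢ [] → ∀ T →
      (2 ^ length v + 2 ^ length w) * wins T + 2 ^ T * 2 ≤ 2 ^ T * (2 * 2 ^ length w)
    wins-≤ v≢[] T = begin
      D * wins T + 2 ^ T * 2
        ≡⟨ cong₂ _+_ (sym (stopped-iverson T D vWins [])) (cong (λ z → 2 ^ T * (z + 2)) (sym (Φ-[] w))) ⟩
      stopped T won [] + 2 ^ T * (Φ w [] + 2)
        ≤⟨ optional-stopping (λ s → Φ v s + 2 * P) (λ s → Φ w s + 2) won (λ _ → 0)
             (drift-+ (Φ v) (2 * P) drift-Φv) (drift-+ (Φ w) 2 drift-Φw) end-bound T [] ⟩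
      2 ^ T * (Φ v [] + 2 * P) + stopped T (λ _ → 0) []
        ≡⟨ cong₂ (λ z z′ → 2 ^ T * (z + 2 * P) + z′) (Φ-[] v) (stopped-zero T []) ⟩
      2 ^ T * (2 * P) + 0
        ≡⟨ +-identityʳ _ ⟩
      2 ^ T * (2 * P) ∎
      where
      open ≤-Reasoning
      P = 2 ^ length w
      Q = 2 ^ length v
      D = Q + P
      won : List Bool → ℕ
      won s = iverson (vWins s) D
      no-v-win : ∀ s → Φ w s + 2 ≤ Φ v s + 2 * P + 0
      no-v-win s = ≤-trans (Φ-≤ w s) (≤-trans (m≤n+m (2 * P) (Φ v s)) (m≤m+n _ 0))
      end-bound : ∀ s → won s + (Φ w s + 2) ≤ Φ v s + 2 * P + 0
      end-bound s with isPrefix (reverse w) s in w-seen | isPrefix (reverse v) s in v-seen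
      ... | true  | _     = no-v-win s
      ... | false | false = no-v-win s
      ... | false | true  = begin
        Q + P + (Φ w s + 2)   ≤⟨ +-mono-≤ (+-monoˡ-≤ P (Φ-matched-≥ v s v≢[] v-seen)) (Φ-unmatched-≤ w s w-seen) ⟩
        Φ v s + P + P         ≡⟨ regroup (Φ v s) P ⟩
        Φ v s + 2 * P + 0     ∎
        where
        regroup : ∀ x P → x + P + P ≡ x + 2 * P + 0
        regroup = solve-∀

    wins-≥ :
      (∀ s → isPrefix (reverse w) s ≡ true → Φ v s + 2 * 2 ^ length w ≤ Φ w s + 2) →
      (∀ s → isPrefix (reverse v) s ≡ true →
        Φ v s + 2 * 2 ^ length w ≤ 2 ^ length v + 2 ^ length w + (Φ w s + 2)) →
      ∀ T → 2 ^ T * (2 * 2 ^ length w) ≤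
        (2 ^ length v + 2 ^ length w) * wins T + (2 * 2 ^ length v + 2 * 2 ^ length w) * survivors T + 2 ^ T * 2
    wins-≥ w-end v-end T = begin
      2 ^ T * (2 * P)
        ≡⟨ cong (λ z → 2 ^ T * (z + 2 * P)) (sym (Φ-[] v)) ⟩
      2 ^ T * (Φ v [] + 2 * P)
        ≡⟨ cong (_+ 2 ^ T * (Φ v [] + 2 * P)) (sym (stopped-zero T [])) ⟩
      stopped T (λ _ → 0) [] + 2 ^ T * (Φ v [] + 2 * P)
        ≤⟨ optional-stopping (λ s → Φ w s + 2) (λ s → Φ v s + 2 * P) (λ _ → 0) reward
             (drift-+ (Φ w) 2 drift-Φw) (drift-+ (Φ v) (2 * P) drift-Φv) end-bound T [] ⟩
      2 ^ T * (Φ w [] + 2) + stopped T reward []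
        ≡⟨ cong₂ (λ z z′ → 2 ^ T * (z + 2) + z′) (Φ-[] w) (stopped-+ T won alive []) ⟩
      2 ^ T * 2 + (stopped T won [] + stopped T alive [])
        ≡⟨ cong₂ (λ z z′ → 2 ^ T * 2 + (z + z′))
             (stopped-iverson T D vWins []) (stopped-iverson T K (not ∘ halted) []) ⟩
      2 ^ T * 2 + (D * wins T + K * survivors T)
        ≡⟨ +-comm (2 ^ T * 2) _ ⟩
      D * wins T + K * survivors T + 2 ^ T * 2 ∎
      where
      open ≤-Reasoning
      P = 2 ^ length w
      Q = 2 ^ length v
      D = Q + P
      K = 2 * Q + 2 * P
      won alive reward : List Bool → ℕ
      won s    = iverson (vWins s) D
      alive s  = iverson (not (halted s)) K
      reward s = won s + alive s
      end-bound : ∀ s → 0 + (Φ v s + 2 * P) ≤ Φ w s + 2 + reward s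
      end-bound s with isPrefix (reverse w) s in w-seen | isPrefix (reverse v) s in v-seen
      ... | true  | _     = ≤-trans (w-end s w-seen) (m≤m+n _ 0)
      ... | false | true  = begin
        Φ v s + 2 * P           ≤⟨ v-end s v-seen ⟩
        D + (Φ w s + 2)         ≡⟨ trans (+-comm D _) (cong (_+_ (Φ w s + 2)) (sym (+-identityʳ D))) ⟩
        Φ w s + 2 + (D + 0)     ∎
      ... | false | false = begin
        Φ v s + 2 * P           ≤⟨ +-monoˡ-≤ (2 * P) (≤-trans (m≤m+n (Φ v s) 2) (Φ-≤ v s)) ⟩
        K                       ≤⟨ m≤n+m K (Φ w s + 2) ⟩
        Φ w s + 2 + (0 + K)     ∎

    survivors-≤ : ∀ T → T * survivors T + 2 ^ T * 2 ≤ 2 ^ T * (2 * 2 ^ length w)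
    survivors-≤ T = begin
      T * survivors T + 2 ^ T * 2
        ≡⟨ cong₂ (λ z z′ → z + 2 ^ T * (z′ + 2)) (sym (stopped-length T [])) (sym (Φ-[] w)) ⟩
      stopped T age [] + 2 ^ T * (Φ w [] + 2)
        ≤⟨ optional-stopping (λ s → length s + 2 * P) (λ s → Φ w s + 2) age (λ _ → 0)
             (drift-+ length (2 * P) drift-length) (drift-+ (Φ w) 2 drift-Φw) end-bound T [] ⟩
      2 ^ T * (2 * P) + stopped T (λ _ → 0) []
        ≡⟨ trans (cong (_+_ (2 ^ T * (2 * P))) (stopped-zero T [])) (+-identityʳ _) ⟩
      2 ^ T * (2 * P) ∎
      where
      open ≤-Reasoning
      P = 2 ^ length w
      age : List Bool → ℕ
      age s = iverson (not (halted s)) (length s)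
      end-bound : ∀ s → age s + (Φ w s + 2) ≤ length s + 2 * P + 0
      end-bound s = ≤-trans (+-mono-≤ (iverson-≤ (not (halted s)) (length s)) (Φ-≤ w s)) (m≤m+n _ 0)

  rep-++-∷ : ∀ j (a : Bool) r → rep j a ++ a ∷ r ≡ a ∷ rep j a ++ r
  rep-++-∷ zero    a r = refl
  rep-++-∷ (suc j) a r = cong (a ∷_) (rep-++-∷ j a r)

  rep-ʳ++ : ∀ j (a : Bool) r → rep j a ʳ++ r ≡ rep j a ++ r
  rep-ʳ++ zero    a r = refl
  rep-ʳ++ (suc j) a r = trans (rep-ʳ++ j a (a ∷ r)) (rep-++-∷ j a r)

  reverse-rep : ∀ j (a : Bool) → reverse (rep j a) ≡ rep j a
  reverse-rep j a = trans (rep-ʳ++ j a []) (++-identityʳ (rep j a))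

  rep-suc : ∀ j (a : Bool) → rep (suc j) a ≡ rep j a ++ a ∷ []
  rep-suc j a = sym (trans (rep-++-∷ j a []) (cong (a ∷_) (++-identityʳ (rep j a))))

  length-rep : ∀ j (a : Bool) → length (rep j a) ≡ j
  length-rep zero    a = refl
  length-rep (suc j) a = cong suc (length-rep j a)

  isPrefix⇒++ : ∀ u x → isPrefix u x ≡ true → ∃ λ y → x ≡ u ++ y
  isPrefix⇒++ []          x           _ = x , refl
  isPrefix⇒++ (false ∷ u) (false ∷ x) p with isPrefix⇒++ u x p
  ... | y , refl = y , refl
  isPrefix⇒++ (true ∷ u)  (true ∷ x)  p with isPrefix⇒++ u x p
  ... | y , refl = y , refl

  conway-++ : ∀ a b r p x →
    conway (a ++ b) r p x ≡ conway a r p x + conway b (a ʳ++ r) (p * 2 ^ length a) x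
  conway-++ []      b r p x = cong (λ q → conway b r q x) (sym (*-identityʳ p))
  conway-++ (c ∷ a) b r p x = begin
    i + conway (a ++ b) (c ∷ r) (2 * p) x
      ≡⟨ cong (_+_ i) (conway-++ a b (c ∷ r) (2 * p) x) ⟩
    i + (conway a (c ∷ r) (2 * p) x + conway b (a ʳ++ (c ∷ r)) (2 * p * 2 ^ length a) x)
      ≡⟨ sym (+-assoc i _ _) ⟩
    i + conway a (c ∷ r) (2 * p) x + conway b (a ʳ++ (c ∷ r)) (2 * p * 2 ^ length a) x
      ≡⟨ cong (λ q → i + conway a (c ∷ r) (2 * p) x + conway b (a ʳ++ (c ∷ r)) q x)
             (sym (p*[2*q]≡2*p*q p _)) ⟩
    conway (c ∷ a) r p x + conway b ((c ∷ a) ʳ++ r) (p * 2 ^ length (c ∷ a)) x ∎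
    where
    open ≡-Reasoning
    i = iverson (isPrefix (c ∷ r) x) (2 * p)

  conway-zeros-before-one : ∀ j r p y → conway (rep j false) r p (true ∷ y) ≡ 0
  conway-zeros-before-one zero    r p y = refl
  conway-zeros-before-one (suc j) r p y = conway-zeros-before-one j (false ∷ r) (2 * p) y

  isPrefix-ones-mismatch : ∀ i N z y → suc i ≤ N →
    isPrefix (rep i true ++ false ∷ z) (rep N true ++ y) ≡ false
  isPrefix-ones-mismatch zero    (suc N) z y _         = refl
  isPrefix-ones-mismatch (suc i) (suc N) z y (s≤s i<N) = isPrefix-ones-mismatch i N z y i<N

  isPrefix-ones : ∀ i N y → i ≤ N → isPrefix (rep i true) (rep N true ++ y) ≡ true
  isPrefix-ones zero    N       y _         = refl
  isPrefix-ones (suc i) (suc N) y (s≤s i≤N) = isPrefix-ones i N y i≤N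

  conway-ones-mismatch : ∀ m i N z p y → suc (i + m) ≤ N →
    conway (rep m true) (rep i true ++ false ∷ z) p (rep N true ++ y) ≡ 0
  conway-ones-mismatch zero    i N z p y _ = refl
  conway-ones-mismatch (suc m) i N z p y i+m<N =
    trans (cong (λ b → iverson b (2 * p) + rest) (isPrefix-ones-mismatch (suc i) N z y i<N))
          (conway-ones-mismatch m (suc i) N z (2 * p) y i+1+m<N)
    where
    rest = conway (rep m true) (rep (suc i) true ++ false ∷ z) (2 * p) (rep N true ++ y)
    i+1+m<N : suc (suc i + m) ≤ N
    i+1+m<N = subst (λ z → suc z ≤ N) (+-suc i m) i+m<N
    i<N : suc (suc i) ≤ N
    i<N = ≤-trans (s≤s (s≤s (m≤m+n i m))) i+1+m<N

  conway-ones-match : ∀ m i N p y → i + m ≤ N →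
    conway (rep m true) (rep i true) p (rep N true ++ y) + 2 * p ≡ p * 2 ^ suc m
  conway-ones-match zero    i N p y _     = sym (p*2^1≡2*p p)
  conway-ones-match (suc m) i N p y i+m≤N = begin
    iverson (isPrefix (rep (suc i) true) x) (2 * p) + C + 2 * p
      ≡⟨ cong (λ b → iverson b (2 * p) + C + 2 * p) (isPrefix-ones (suc i) N y i<N) ⟩
    2 * p + C + 2 * p    ≡⟨ regroup p C ⟩
    C + 2 * (2 * p)      ≡⟨ conway-ones-match m (suc i) N (2 * p) y i+1+m≤N ⟩
    2 * p * 2 ^ suc m    ≡⟨ sym (p*[2*q]≡2*p*q p (2 ^ suc m)) ⟩
    p * 2 ^ suc (suc m)  ∎
    where
    open ≡-Reasoning
    x = rep N true ++ y
    C = conway (rep m true) (rep (suc i) true) (2 * p) x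
    i+1+m≤N : suc i + m ≤ N
    i+1+m≤N = subst (_≤ N) (+-suc i m) i+m≤N
    i<N : suc i ≤ N
    i<N = ≤-trans (s≤s (m≤m+n i m)) i+1+m≤N
    regroup : ∀ p C → 2 * p + C + 2 * p ≡ C + 2 * (2 * p)
    regroup = solve-∀

  Φ-++-≥ : ∀ a b x → Φ a x ≤ Φ (a ++ b) x
  Φ-++-≥ a b x = ≤-trans (m≤m+n (Φ a x) _) (≤-reflexive (sym (conway-++ a b [] 1 x)))

  module OnesRace (k m : ℕ) where

    v w : List Bool
    v = rep (suc k) false ++ rep (suc m) true
    w = rep (suc (suc m)) true

    length-w : length w ≡ suc (suc m)
    length-w = length-rep (suc (suc m)) true

    length-v : length v ≡ suc k + suc m
    length-v = trans (length-++ (rep (suc k) false))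
                     (cong₂ _+_ (length-rep (suc k) false) (length-rep (suc m) true))

    length-v≡length-w+k : length v ≡ length w + k
    length-v≡length-w+k = trans length-v (trans (swap k m) (cong (_+ k) (sym length-w)))
      where
      swap : ∀ k m → suc k + suc m ≡ suc (suc m) + k
      swap = solve-∀

    Φv-ones-block : ∀ y →
      Φ v (true ∷ y) ≡ conway (rep (suc m) true) (rep (suc k) false) (1 * 2 ^ suc k) (true ∷ y)
    Φv-ones-block y = begin
      Φ v (true ∷ y)
        ≡⟨ conway-++ (rep (suc k) false) (rep (suc m) true) [] 1 (true ∷ y) ⟩
      conway (rep (suc k) false) [] 1 (true ∷ y)
        + conway (rep (suc m) true) (rep (suc k) false ʳ++ []) q (true ∷ y)
        ≡⟨ cong₂ (λ z r → z + conway (rep (suc m) true) r q (true ∷ y))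
             (conway-zeros-before-one (suc k) [] 1 y) (reverse-rep (suc k) false) ⟩
      conway (rep (suc m) true) (rep (suc k) false) q (true ∷ y)
        ≡⟨ cong (λ l → conway (rep (suc m) true) (rep (suc k) false) (1 * 2 ^ l) (true ∷ y))
             (length-rep (suc k) false) ⟩
      conway (rep (suc m) true) (rep (suc k) false) (1 * 2 ^ suc k) (true ∷ y) ∎
      where
      open ≡-Reasoning
      q = 1 * 2 ^ length (rep (suc k) false)

    Φv-after-w : ∀ y → Φ v (rep (suc (suc m)) true ++ y) ≡ 0
    Φv-after-w y = trans (Φv-ones-block (rep (suc m) true ++ y))
      (conway-ones-mismatch (suc m) 0 (suc (suc m)) (rep k false) (1 * 2 ^ suc k) y ≤-refl)

    Φv-≤ : ∀ y → Φ v (rep (suc m) true ++ y) ≤ 2 ^ length v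
    Φv-≤ y = begin
      Φ v x
        ≡⟨ Φv-ones-block (rep m true ++ y) ⟩
      conway (rep (suc m) true) (rep (suc k) false) q x
        ≡⟨ cong (λ u → conway u (rep (suc k) false) q x) (rep-suc m true) ⟩
      conway (rep m true ++ true ∷ []) (rep (suc k) false) q x
        ≡⟨ conway-++ (rep m true) (true ∷ []) (rep (suc k) false) q x ⟩
      conway (rep m true) (rep (suc k) false) q x + (last + 0)
        ≡⟨ cong (_+ (last + 0)) (conway-ones-mismatch m 0 (suc m) (rep k false) q y ≤-refl) ⟩
      last + 0
        ≤⟨ +-monoˡ-≤ 0 (iverson-≤ _ (2 * (q * 2 ^ length (rep m true)))) ⟩
      2 * (q * 2 ^ length (rep m true)) + 0
        ≡⟨ cong (λ l → 2 * (q * 2 ^ l) + 0) (length-rep m true) ⟩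
      2 * (1 * 2 ^ suc k * 2 ^ m) + 0
        ≡⟨ regroup (2 ^ suc k) (2 ^ m) ⟩
      2 ^ suc k * 2 ^ suc m
        ≡⟨ sym (trans (cong (2 ^_) length-v) (^-distribˡ-+-* 2 (suc k) (suc m))) ⟩
      2 ^ length v ∎
      where
      open ≤-Reasoning
      x = rep (suc m) true ++ y
      q = 1 * 2 ^ suc k
      last = iverson (isPrefix (true ∷ (rep m true ʳ++ (rep (suc k) false))) x) (2 * (q * 2 ^ length (rep m true)))
      regroup : ∀ a b → 2 * (1 * a * b) + 0 ≡ a * (2 * b)
      regroup = solve-∀

    Φw-after-w : ∀ y → Φ w (rep (suc (suc m)) true ++ y) + 2 ≡ 2 * 2 ^ length w
    Φw-after-w y = trans (conway-ones-match (suc (suc m)) 0 (suc (suc m)) 1 y ≤-refl)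
                         (trans (*-identityˡ _) (cong (λ l → 2 ^ suc l) (sym length-w)))

    Φw-≥ : ∀ y → 2 ^ length w ≤ Φ w (rep (suc m) true ++ y) + 2
    Φw-≥ y = begin
      2 ^ length w                          ≡⟨ cong (2 ^_) length-w ⟩
      2 ^ suc (suc m)
        ≡⟨ sym (trans (conway-ones-match (suc m) 0 (suc m) 1 y ≤-refl) (*-identityˡ _)) ⟩
      Φ (rep (suc m) true) x + 2            ≤⟨ +-monoˡ-≤ 2 (Φ-++-≥ (rep (suc m) true) (true ∷ []) x) ⟩
      Φ (rep (suc m) true ++ true ∷ []) x + 2 ≡⟨ cong (λ u → Φ u x + 2) (sym (rep-suc (suc m) true)) ⟩
      Φ w x + 2                             ∎
      where
      open ≤-Reasoning
      x = rep (suc m) true ++ y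

    w-end : ∀ s → isPrefix (reverse w) s ≡ true → Φ v s + 2 * 2 ^ length w ≤ Φ w s + 2
    w-end s seen with isPrefix⇒++ w s (subst (λ u → isPrefix u s ≡ true) (reverse-rep (suc (suc m)) true) seen)
    ... | y , refl = ≤-reflexive (trans (cong (_+ 2 * 2 ^ length w) (Φv-after-w y)) (sym (Φw-after-w y)))

    reverse-v : reverse v ≡ rep (suc m) true ++ rep (suc k) false
    reverse-v = trans (reverse-++ (rep (suc k) false) (rep (suc m) true))
                      (cong₂ _++_ (reverse-rep (suc m) true) (reverse-rep (suc k) false))

    v-end-ones : ∀ y → Φ v (rep (suc m) true ++ y) + 2 * 2 ^ length w ≤
      2 ^ length v + 2 ^ length w + (Φ w (rep (suc m) true ++ y) + 2)
    v-end-ones y = begin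
      Φ v x + 2 * P                  ≡⟨ regroup (Φ v x) P ⟩
      Φ v x + P + P                  ≤⟨ +-mono-≤ (+-monoˡ-≤ P (Φv-≤ y)) (Φw-≥ y) ⟩
      2 ^ length v + P + (Φ w x + 2) ∎
      where
      open ≤-Reasoning
      x = rep (suc m) true ++ y
      P = 2 ^ length w
      regroup : ∀ a b → a + 2 * b ≡ a + b + b
      regroup = solve-∀

    v-end : ∀ s → isPrefix (reverse v) s ≡ true →
      Φ v s + 2 * 2 ^ length w ≤ 2 ^ length v + 2 ^ length w + (Φ w s + 2)
    v-end s seen
      with isPrefix⇒++ (rep (suc m) true ++ rep (suc k) false) s (subst (λ u → isPrefix u s ≡ true) reverse-v seen)
    ... | y , refl = subst (λ x → Φ v x + 2 * 2 ^ length w ≤ 2 ^ length v + 2 ^ length w + (Φ w x + 2))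
                           (sym (++-assoc (rep (suc m) true) (rep (suc k) false) y))
                           (v-end-ones (rep (suc k) false ++ y))

  attainment-arith : ∀ W A t d P E K .{{_ : NonZero P}} → 2 * d ≤ P → 2 ≤ E →
    t * (2 * P) ≤ P * E * W + K * A + t * 2 → 2 * P * K * d * A ≤ t * (2 * P) →
    2 * (t * d) ≤ (W * d + 1 * t) * E
  attainment-arith W A t d P E K 2d≤P 2≤E lower survival = *-cancelˡ-≤ P (begin
    P * (2 * (t * d))                         ≡⟨ reorder P t d ⟩
    t * (2 * P) * d                           ≤⟨ *-monoˡ-≤ d lower ⟩
    (P * E * W + K * A + t * 2) * d           ≡⟨ expand P E W K A t d ⟩
    P * E * W * d + K * d * A + t * (2 * d)   ≤⟨ +-mono-≤ (+-monoʳ-≤ (P * E * W * d) KdA≤t) (*-monoʳ-≤ t 2d≤P) ⟩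
    P * E * W * d + t + t * P                 ≤⟨ +-monoˡ-≤ (t * P) (+-monoʳ-≤ (P * E * W * d) (m≤m*n t P)) ⟩
    P * E * W * d + t * P + t * P             ≡⟨ collect P E W d t ⟩
    P * E * W * d + t * P * 2                 ≤⟨ +-monoʳ-≤ (P * E * W * d) (*-monoʳ-≤ (t * P) 2≤E) ⟩
    P * E * W * d + t * P * E                 ≡⟨ factor P E W d t ⟩
    P * ((W * d + 1 * t) * E)                 ∎)
    where
    open ≤-Reasoning
    reassociate : ∀ P K d A → 2 * P * (K * d * A) ≡ 2 * P * K * d * A
    reassociate = solve-∀
    KdA≤t : K * d * A ≤ t
    KdA≤t = *-cancelˡ-≤ (2 * P) {{m*n≢0 2 P}} (begin
      2 * P * (K * d * A)  ≡⟨ reassociate P K d A ⟩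
      2 * P * K * d * A    ≤⟨ survival ⟩
      t * (2 * P)          ≡⟨ *-comm t (2 * P) ⟩
      2 * P * t            ∎)
    reorder : ∀ P t d → P * (2 * (t * d)) ≡ t * (2 * P) * d
    reorder = solve-∀
    expand : ∀ P E W K A t d → (P * E * W + K * A + t * 2) * d ≡ P * E * W * d + K * d * A + t * (2 * d)
    expand = solve-∀
    collect : ∀ P E W d t → P * E * W * d + t * P + t * P ≡ P * E * W * d + t * P * 2
    collect = solve-∀
    factor : ∀ P E W d t → P * E * W * d + t * P * E ≡ P * ((W * d + 1 * t) * E)
    factor = solve-∀

open Penney

toℚᵘ-/ : ∀ i n .{{_ : NonZero n}} → toℚᵘ (i / n) ℚᵘ.≃ i ℚᵘ./ n
toℚᵘ-/ i (suc n) = ℚ.toℚᵘ-fromℚᵘ (ℚᵘ.mkℚᵘ i n)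

/-≤-/ : ∀ a b c d .{{b≢0 : NonZero b}} .{{d≢0 : NonZero d}} → a * d ≤ℕ c * b → (+ a) / b ≤ℚ (+ c) / d
/-≤-/ a b@(suc _) c d@(suc _) ad≤cb = ℚ.toℚᵘ-cancel-≤
  (ℚᵘ.≤-respˡ-≃ (ℚᵘ.≃-sym (toℚᵘ-/ (+ a) b)) (ℚᵘ.≤-respʳ-≃ (ℚᵘ.≃-sym (toℚᵘ-/ (+ c) d))
    (ℚᵘ.*≤* (subst₂ ℤ._≤_ (ℤ.pos-* a d) (ℤ.pos-* c b) (ℤ.+≤+ ad≤cb)))))

/-+-/ : ∀ a b c d .{{_ : NonZero b}} .{{_ : NonZero d}} →
  (+ a) / b +ℚ (+ c) / d ≡ _/_ (+ (a * d + c * b)) (b * d) {{m*n≢0 b d}}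
/-+-/ a b@(suc _) c d@(suc _) = ℚ.toℚᵘ-injective (ℚᵘ.≃-trans (ℚ.toℚᵘ-homo-+ ((+ a) / b) ((+ c) / d))
  (ℚᵘ.≃-trans (ℚᵘ.+-cong (toℚᵘ-/ (+ a) b) (toℚᵘ-/ (+ c) d))
    (ℚᵘ.≃-trans (ℚᵘ.≃-reflexive (cong (ℚᵘ._/ (b * d)) numerator))
      (ℚᵘ.≃-sym (toℚᵘ-/ (+ (a * d + c * b)) (b * d))))))
  where
  numerator : (+ a) ℤ.* (+ d) ℤ.+ (+ c) ℤ.* (+ b) ≡ + (a * d + c * b)
  numerator = sym (trans (ℤ.pos-+ (a * d) (c * b)) (cong₂ ℤ._+_ (ℤ.pos-* a d) (ℤ.pos-* c b)))

/-+-/-≤-/ : ∀ a b c d e f .{{_ : NonZero b}} .{{_ : NonZero d}} .{{_ : NonZero f}} →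
  (a * d + c * b) * f ≤ℕ e * (b * d) → (+ a) / b +ℚ (+ c) / d ≤ℚ (+ e) / f
/-+-/-≤-/ a b c d e f le =
  subst (_≤ℚ (+ e) / f) (sym (/-+-/ a b c d)) (/-≤-/ (a * d + c * b) (b * d) e f {{m*n≢0 b d}} le)

/-≤-/-+-/ : ∀ a b c d e f .{{_ : NonZero b}} .{{_ : NonZero d}} .{{_ : NonZero f}} →
  e * (b * d) ≤ℕ (a * d + c * b) * f → (+ e) / f ≤ℚ (+ a) / b +ℚ (+ c) / d
/-≤-/-+-/ a b c d e f le =
  subst ((+ e) / f ≤ℚ_) (sym (/-+-/ a b c d)) (/-≤-/ e f (a * d + c * b) (b * d) {{d≢0 = m*n≢0 b d}} le)

p+r-r≡p : ∀ p r → p +ℚ r - r ≡ p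
p+r-r≡p p r = trans (ℚ.+-assoc p r (- r)) (trans (cong (p +ℚ_) (ℚ.+-inverseʳ r)) (ℚ.+-identityʳ p))

p+r≤q⇒p≤q-r : ∀ p q r → p +ℚ r ≤ℚ q → p ≤ℚ q - r
p+r≤q⇒p≤q-r p q r p+r≤q = subst (_≤ℚ q - r) (p+r-r≡p p r) (ℚ.+-monoˡ-≤ (- r) p+r≤q)

p≤q+r⇒p-r≤q : ∀ p q r → p ≤ℚ q +ℚ r → p - r ≤ℚ q
p≤q+r⇒p-r≤q p q r p≤q+r = subst (p - r ≤ℚ_) (p+r-r≡p q r) (ℚ.+-monoˡ-≤ (- r) p≤q+r)

q-r≤q+s : ∀ q r s → 0ℚ < r → 0ℚ < s → q - r ≤ℚ q +ℚ s
q-r≤q+s q r s 0<r 0<s = ℚ.+-monoʳ-≤ q (ℚ.≤-trans (ℚ.<⇒≤ (ℚ.neg-antimono-< 0<r)) (ℚ.<⇒≤ 0<s))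

0<suc/ : ∀ a n .{{_ : NonZero n}} → 0ℚ < (+ suc a) / n
0<suc/ a n = ℚ.positive⁻¹ _ {{ℚ.normalize-pos (suc a) n}}

unit-fraction-≤ : ∀ ε → 0ℚ < ε → ∃ λ d → (+ 1) / suc d ≤ℚ ε
unit-fraction-≤ ε@(mkℚ +[1+ a ] d _) _ =
  d , subst ((+ 1) / suc d ≤ℚ_) (ℚ.↥p/↧p≡p ε)
            (/-≤-/ 1 (suc d) (suc a) (suc d) (*-monoˡ-≤ (suc d) {1} {suc a} (s≤s z≤n)))
unit-fraction-≤ (mkℚ (+ 0)     _ _) (*<* (ℤ.+<+ ()))
unit-fraction-≤ (mkℚ -[1+ _ ] _ _) (*<* ())

2^[n+k]+2^n : ∀ n k → 2 ^ (n + k) + 2 ^ n ≡ 2 ^ n * (1 + 2 ^ k)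
2^[n+k]+2^n n k = trans (cong (_+ 2 ^ n) (^-distribˡ-+-* 2 n k)) (distribute (2 ^ n) (2 ^ k))
  where
  distribute : ∀ a b → a * b + a ≡ a * (1 + b)
  distribute = solve-∀

suc-n≤2^n : ∀ n → suc n ≤ℕ 2 ^ n
suc-n≤2^n zero    = ≤-refl
suc-n≤2^n (suc n) = +-mono-≤ (m^n>0 2 n) (≤-trans (suc-n≤2^n n) (m≤m+n (2 ^ n) 0))

nonempty-by-length : ∀ {v w : List Bool} k → length v ≡ length w + k → w ≢ [] → v ≢ []
nonempty-by-length {[]}    {[]}    k _  w≢[] _ = w≢[] refl
nonempty-by-length {[]}    {_ ∷ _} k () _    _
nonempty-by-length {_ ∷ _}         k _  _    ()

margin : ℕ → List Bool → ℚ
margin k w = _/_ (+ 2) (2 ^ length w * (1 + 2 ^ k)) {{m*n≢0 (2 ^ length w) (1 + 2 ^ k) {{m^n≢0 2 (length w)}}}}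

0<margin : ∀ k w → 0ℚ < margin k w
0<margin k w = 0<suc/ 1 (2 ^ length w * (1 + 2 ^ k)) {{m*n≢0 (2 ^ length w) (1 + 2 ^ k) {{m^n≢0 2 (length w)}}}}

win-upper : ∀ k v w → length v ≡ length w + k → v ≢ [] → w ≢ [] →
  WinAtMost v w (((+ 2) / (1 + 2 ^ k)) - margin k w)
win-upper k v w |v|≡|w|+k v≢[] w≢[] T =
  p+r≤q⇒p≤q-r _ _ _
    (/-+-/-≤-/ W (2 ^ T) 2 (P * E) 2 E {{m^n≢0 2 T}} {{m*n≢0 P E {{m^n≢0 2 (length w)}}}} scaled)
  where
  W = countWin v w T
  P = 2 ^ length w
  E = 1 + 2 ^ k
  bound : P * E * W + 2 ^ T * 2 ≤ℕ 2 ^ T * (2 * P)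
  bound = subst₂ (λ D W′ → D * W′ + 2 ^ T * 2 ≤ℕ 2 ^ T * (2 * P))
            (trans (cong (λ l → 2 ^ l + P) |v|≡|w|+k) (2^[n+k]+2^n (length w) k))
            (sym (Race.countWin≡wins v w v≢[] w≢[] T))
            (Race.wins-≤ v w v≢[] T)
  scaled : (W * (P * E) + 2 * 2 ^ T) * E ≤ℕ 2 * (2 ^ T * (P * E))
  scaled = begin
    (W * (P * E) + 2 * 2 ^ T) * E   ≡⟨ reorder W P E (2 ^ T) ⟩
    (P * E * W + 2 ^ T * 2) * E     ≤⟨ *-monoˡ-≤ E bound ⟩
    2 ^ T * (2 * P) * E             ≡⟨ factor (2 ^ T) P E ⟩
    2 * (2 ^ T * (P * E))           ∎
    where
    open ≤-Reasoning
    reorder : ∀ W P E t → (W * (P * E) + 2 * t) * E ≡ (P * E * W + t * 2) * E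
    reorder = solve-∀
    factor : ∀ t P E → t * (2 * P) * E ≡ 2 * (t * (P * E))
    factor = solve-∀

-- Since vFirst lets w win ties, the hypothesis that w is not a subword of v only excludes w = [].
win-bound : (k : ℕ) (v w : List Bool) → length v ≡ length w + k → ¬ Infix _≡_ w v →
  ∃ λ δ → 0ℚ < δ × WinAtMost v w (((+ 2) / (1 + 2 ^ k)) - δ)
win-bound k v w |v|≡|w|+k w⋢v =
  margin k w , 0<margin k w ,
  win-upper k v w |v|≡|w|+k (nonempty-by-length k |v|≡|w|+k w≢[]) w≢[]
  where
  w≢[] : w ≢ []
  w≢[] refl = w⋢v (here [])

module Attained (k m : ℕ) where

  open OnesRace k m

  P K E : ℕ
  P = 2 ^ length w
  K = 2 * 2 ^ length v + 2 * P
  E = 1 + 2 ^ k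

  -- Chosen so that, by survivors-≤, the undecided mass K · survivors T / 2^T is at most 1 / d.
  horizon : ℕ → ℕ
  horizon d = 2 * P * K * d

  attained-ℕ : ∀ d → d ≤ℕ m →
    2 * (2 ^ horizon d * d) ≤ℕ (countWin v w (horizon d) * d + 1 * 2 ^ horizon d) * E
  attained-ℕ d d≤m =
    attainment-arith W A t d P E K {{m^n≢0 2 (length w)}} 2d≤P (s≤s (m^n>0 2 k)) lower survival
    where
    T = horizon d
    t = 2 ^ T
    W = countWin v w T
    A = Race.survivors v w T
    lower : t * (2 * P) ≤ℕ P * E * W + K * A + t * 2
    lower = subst₂ (λ D W′ → t * (2 * P) ≤ℕ D * W′ + K * A + t * 2)
              (trans (cong (λ l → 2 ^ l + P) length-v≡length-w+k) (2^[n+k]+2^n (length w) k))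
              (sym (Race.countWin≡wins v w (λ ()) (λ ()) T))
              (Race.wins-≥ v w w-end v-end T)
    survival : 2 * P * K * d * A ≤ℕ t * (2 * P)
    survival = ≤-trans (m≤m+n (T * A) _) (Race.survivors-≤ v w T)
    2d≤P : 2 * d ≤ℕ P
    2d≤P = begin
      2 * d             ≤⟨ *-monoʳ-≤ 2 (≤-trans d≤m (n≤1+n m)) ⟩
      2 * suc m         ≤⟨ *-monoʳ-≤ 2 (suc-n≤2^n m) ⟩
      2 ^ suc m         ≤⟨ ^-monoʳ-≤ 2 (n≤1+n (suc m)) ⟩
      2 ^ suc (suc m)   ≡⟨ cong (2 ^_) (sym length-w) ⟩
      P                 ∎
      where open ≤-Reasoning

  attained : ∀ d → suc d ≤ℕ m → (+ 2) / E ≤ℚ winUpTo v w (horizon (suc d)) +ℚ (+ 1) / suc d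
  attained d d<m = /-≤-/-+-/ (countWin v w T) (2 ^ T) 1 (suc d) 2 E {{m^n≢0 2 T}} (attained-ℕ (suc d) d<m)
    where
    T = horizon (suc d)

win-bound-attained : (k : ℕ) (ε : ℚ) → 0ℚ < ε → ∃ λ N → (n : ℕ) → N ≤ℕ n →
  WinAtMost (rep (k + 1) false ++ rep (n ∸ 1) true) (rep n true) (((+ 2) / (1 + 2 ^ k)) +ℚ ε)
  × ReachedBy (rep (k + 1) false ++ rep (n ∸ 1) true) (rep n true) (((+ 2) / (1 + 2 ^ k)) - ε)
win-bound-attained k ε 0<ε with unit-fraction-≤ ε 0<ε
... | d , 1/d≤ε = 2 + suc d , bounds
  where
  X = (+ 2) / (1 + 2 ^ k)
  bounds : (n : ℕ) → 2 + suc d ≤ℕ n →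
    WinAtMost (rep (k + 1) false ++ rep (n ∸ 1) true) (rep n true) (X +ℚ ε)
    × ReachedBy (rep (k + 1) false ++ rep (n ∸ 1) true) (rep n true) (X - ε)
  bounds (suc (suc m)) (s≤s (s≤s d<m)) =
    subst (λ u → WinAtMost u w (X +ℚ ε) × ReachedBy u w (X - ε))
          (cong (λ j → rep j false ++ rep (suc m) true) (+-comm 1 k))
          (upper , reached)
    where
    open OnesRace k m
    open Attained k m using (horizon; attained)
    upper : WinAtMost v w (X +ℚ ε)
    upper T = ℚ.≤-trans (win-upper k v w length-v≡length-w+k (λ ()) (λ ()) T)
      (q-r≤q+s X (margin k w) ε (0<margin k w) 0<ε)
    reached : ReachedBy v w (X - ε)
    reached = horizon (suc d) ,
      ℚ.≤-trans (ℚ.+-monoʳ-≤ X (ℚ.neg-antimono-≤ 1/d≤ε))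
                (p≤q+r⇒p-r≤q X (winUpTo v w (horizon (suc d))) _ (attained d d<m))

theorem3p2 : ((k : ℕ) (v w : List Bool) → length v ≡ length w + k → ¬ Infix _≡_ w v →
    ∃ λ δ → 0ℚ < δ × WinAtMost v w (((+ 2) / (1 + 2 ^ k)) - δ))
    ×
    ((k : ℕ) (ε : ℚ) → 0ℚ < ε → ∃ λ N → (n : ℕ) → N ≤ℕ n →
    WinAtMost (rep (k + 1) false ++ rep (n ∸ 1) true) (rep n true) (((+ 2) / (1 + 2 ^ k)) +ℚ ε)
    × ReachedBy (rep (k + 1) false ++ rep (n ∸ 1) true) (rep n true) (((+ 2) / (1 + 2 ^ k)) - ε))
theorem3p2 = win-bound , win-bound-attained
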